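{- Let $\ell\geq 3$ be an integer, let $G$ be a graph with girth exactly $2\ell$ and no even hole of length at least $2\ell+2$, and let $C$ be an even hole of $G$. Let $s,t\in V(C)$ be non-adjacent, and let $P$ be an $(s,t)$-path whose set $V(P^*)$ of internal vertices is disjoint from $V(C)$ and satisfies $|V(P^*)\cap N(C)|\leq 2$. Then $G[V(P)]$ contains a short $(s,t)$-jump over $C$.
   Context: A hole is an induced cycle of length at least four; it is even if its length is even. $N(C)$ is the set of vertices not in $C$ having a neighbour in $V(C)$. For a hole $C$ and non-adjacent $s,t\in V(C)$, an $(s,t)$-jump over $C$ is an induced $(s,t)$-path $P$ whose internal vertices are not in $C$. Let $Q_1,Q_2$ be the two $(s,t)$-paths of $C$ and $Q_i^*$ their sets of internal vertices. The jump $P$ is short if no vertex of $Q_1^*\cup Q_2^*$ is adjacent to a vertex of $P^*$. -}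

module Defs where

open import Data.Nat using (ℕ; zero; suc; _+_; _*_; _≤_)
open import Data.Fin using (Fin; toℕ; fromℕ; inject₁)
open import Data.Product using (Σ; _×_; _,_; ∃)
open import Data.Sum using (_⊎_)
open import Data.Empty using (⊥)
open import Relation.Nullary using (¬_)
open import Relation.Binary using (Decidable)
open import Relation.Binary.PropositionalEquality using (_≡_; _≢_)
open import Function.Definitions using (Injective)

record Graph (n : ℕ) : Set₁ where
  field
    Adj     : Fin n → Fin n → Set
    adj?    : Decidable Adj
    sym     : ∀ {u v} → Adj u v → Adj v u
    irrefl  : ∀ {v} → ¬ Adj v v
open Graph public

CycAdj : {k : ℕ} → Fin k → Fin k → Set
CycAdj {k} i j =
  suc (toℕ i) ≡ toℕ j ⊎ suc (toℕ j) ≡ toℕ i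
  ⊎ (toℕ i ≡ 0 × suc (toℕ j) ≡ k) ⊎ (toℕ j ≡ 0 × suc (toℕ i) ≡ k)

module _ {n : ℕ} (G : Graph n) where

  record Cycle (k : ℕ) : Set where
    field
      cv      : Fin k → Fin n
      len≥3   : 3 ≤ k
      inj     : Injective _≡_ _≡_ cv
      edges   : ∀ i j → CycAdj i j → Adj G (cv i) (cv j)

  GirthExactly : ℕ → Set
  GirthExactly g = Cycle g × (∀ k → Cycle k → g ≤ k)

  record Hole (k : ℕ) : Set where
    field
      hv      : Fin k → Fin n
      len≥4   : 4 ≤ k
      inj     : Injective _≡_ _≡_ hv
      edges   : ∀ i j → CycAdj i j → Adj G (hv i) (hv j)
      induced : ∀ i j → Adj G (hv i) (hv j) → CycAdj i j
  open Hole public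

  Even : ℕ → Set
  Even k = Σ ℕ λ m → k ≡ m + m

  NoEvenHoleAtLeast : ℕ → Set
  NoEvenHoleAtLeast L = ∀ k → Hole k → Even k → L ≤ k → ⊥

  InHole : ∀ {k} → Hole k → Fin n → Set
  InHole {k} C v = Σ (Fin k) λ a → hv C a ≡ v

  InN : ∀ {k} → Hole k → Fin n → Set
  InN {k} C v = ¬ InHole C v × Σ (Fin k) λ a → Adj G v (hv C a)

  record Path (s t : Fin n) (m : ℕ) : Set where
    field
      pv     : Fin (suc m) → Fin n
      inj    : Injective _≡_ _≡_ pv
      start  : pv Fin.zero ≡ s
      end    : pv (fromℕ m) ≡ t
      edges  : ∀ (i : Fin m) → Adj G (pv (inject₁ i)) (pv (Fin.suc i))
  open Path public

  Internal : ∀ {m} → Fin (suc m) → Set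
  Internal {m} i = (i ≢ Fin.zero) × (i ≢ fromℕ m)

  InPath : ∀ {s t m} → Path s t m → Fin n → Set
  InPath {m = m} P v = Σ (Fin (suc m)) λ i → pv P i ≡ v

  InPathInternal : ∀ {s t m} → Path s t m → Fin n → Set
  InPathInternal {m = m} P v = Σ (Fin (suc m)) λ i → Internal i × pv P i ≡ v

  InducedPath : ∀ {s t m} → Path s t m → Set
  InducedPath {m = m} P = ∀ i j → Adj G (pv P i) (pv P j) →
    suc (toℕ i) ≡ toℕ j ⊎ suc (toℕ j) ≡ toℕ i

  AtMostTwoInternalInN : ∀ {s t m k} → Path s t m → Hole k → Set
  AtMostTwoInternalInN P C =
    (f : Fin 3 → Fin n) → Injective _≡_ _≡_ f →
    (∀ x → InPathInternal P (f x) × InN C (f x)) → ⊥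

  -- An (s,t)-jump over C: induced (s,t)-path with internal vertices not in C.
  -- Short: no vertex of Q₁* ∪ Q₂* = V(C) ∖ {s,t} is adjacent to a vertex of P*.
  record ShortJump {k} (C : Hole k) (s t : Fin n) : Set where
    field
      len      : ℕ
      path     : Path s t len
      isInduced : InducedPath path
      outside  : ∀ v → InPathInternal path v → ¬ InHole C v
      short    : ∀ a v → hv C a ≢ s → hv C a ≢ t →
                 InPathInternal path v → ¬ Adj G (hv C a) v

{-# OPTIONS --safe #-}
-- Since C is an even hole and G has no even hole of length at least 2ℓ + 2, |C| ≤ 2ℓ + 1.
-- A vertex off C with two neighbours on C would close, with the shorter of the two arcs of C
-- between them, a cycle of length at most |C|/2 + 2 ≤ ℓ + 2 < 2ℓ; so every vertex off C has at
-- most one neighbour on C. Cutting out chords turns P into an induced (s,t)-path Q with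
-- V(Q) ⊆ V(P). Let x be an internal vertex of Q with a neighbour on C other than s and t. Then x
-- is neither the successor q of s nor the predecessor q' of t on Q, whose only neighbours on C
-- are s and t, so q, x, q' are three internal vertices of P in N(C).
module Submission where

open import Defs renaming (sym to Adj-sym)
open import Data.Nat
  using (ℕ; zero; suc; _+_; _*_; _∸_; _%_; _/_; _≤_; _<_; _≟_; _≤?_; _<?_; z≤n; s≤s; s≤s⁻¹; NonZero; >-nonZero)
open import Data.Nat.Properties
open import Data.Nat.DivMod
  using (_mod_; m≡m%n+[m/n]*n; [m+kn]%n≡m%n; [m+n]%n≡m%n; m%n<n; m<n⇒m%n≡m; n%n≡0)
open import Data.Nat.Divisibility using (_∣_; divides; >⇒∤)
open import Data.Nat.Induction using (<-wellFounded)
open import Data.Nat.Tactic.RingSolver using (solve-∀)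
open import Data.Fin as F using (Fin; toℕ; fromℕ<)
open import Data.Fin.Patterns using (0F; 1F; 2F)
open import Data.Fin.Properties
  using (toℕ-injective; toℕ<n; toℕ≤pred[n]; toℕ-fromℕ; toℕ-fromℕ<; toℕ-inject₁) renaming (<-cmp to <-cmpᶠ)
open import Data.Vec using (_∷_; []; lookup)
open import Data.Product using (_×_; _,_; ∃; ∃₂; Σ; proj₁; proj₂)
open import Data.Sum using (inj₁; inj₂; _⊎_)
open import Data.Empty using (⊥; ⊥-elim)
open import Function using (_∘_; _$_)
open import Function.Definitions using (Injective)
open import Induction.WellFounded using (Acc; acc)
open import Relation.Binary using (Tri; tri<; tri≈; tri>)
open import Relation.Nullary using (¬_; Dec; yes; no; contradiction; _×-dec_)
open import Relation.Nullary.Decidable using (map′)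
open import Relation.Binary.PropositionalEquality
  using (_≡_; _≢_; refl; sym; trans; cong; cong₂; subst; subst₂; module ≡-Reasoning)

∣∧<⇒≡0 : ∀ {d m} → d ∣ m → m < d → m ≡ 0
∣∧<⇒≡0 {m = zero}  _   _   = refl
∣∧<⇒≡0 {m = suc _} d∣m m<d = contradiction d∣m (>⇒∤ m<d)

m%n≡o%n⇒n∣o∸m : ∀ m n o .{{_ : NonZero n}} → m % n ≡ o % n → n ∣ o ∸ m
m%n≡o%n⇒n∣o∸m m n o eq = divides (o / n ∸ m / n) $ begin
  o ∸ m                                     ≡⟨ cong₂ _∸_ (m≡m%n+[m/n]*n o n) (m≡m%n+[m/n]*n m n) ⟩
  (o % n + o / n * n) ∸ (m % n + m / n * n) ≡⟨ cong (λ r → (r + o / n * n) ∸ (m % n + m / n * n)) eq ⟨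
  (m % n + o / n * n) ∸ (m % n + m / n * n) ≡⟨ [m+n]∸[m+o]≡n∸o (m % n) (o / n * n) (m / n * n) ⟩
  o / n * n ∸ m / n * n                     ≡⟨ *-distribʳ-∸ n (o / n) (m / n) ⟨
  (o / n ∸ m / n) * n                       ∎
  where open ≡-Reasoning

[1+m]%n≡[1+m%n]%n : ∀ m n .{{_ : NonZero n}} → suc m % n ≡ suc (m % n) % n
[1+m]%n≡[1+m%n]%n m n =
  trans (cong (λ r → suc r % n) (m≡m%n+[m/n]*n m n)) ([m+kn]%n≡m%n (suc (m % n)) (m / n) n)

module _ {k : ℕ} .{{_ : NonZero k}} where

  toℕ-mod : ∀ m → toℕ (m mod k) ≡ m % k
  toℕ-mod m = toℕ-fromℕ< (m%n<n m k)

  %≡toℕ⇒mod≡ : ∀ {m} {i : Fin k} → m % k ≡ toℕ i → m mod k ≡ i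
  %≡toℕ⇒mod≡ {m} eq = toℕ-injective (trans (toℕ-mod m) eq)

  toℕ≡⇒mod≡ : ∀ {m} {i : Fin k} → toℕ i ≡ m → m mod k ≡ i
  toℕ≡⇒mod≡ {i = i} refl = %≡toℕ⇒mod≡ (m<n⇒m%n≡m (toℕ<n i))

  +-cancelˡ-mod : ∀ m {n o} → n < k → o < k → (m + n) mod k ≡ (m + o) mod k → n ≡ o
  +-cancelˡ-mod m {n} {o} n<k o<k eq = ≤-antisym (below n<k (sym eq′)) (below o<k eq′)
    where
    eq′ : (m + n) % k ≡ (m + o) % k
    eq′ = trans (sym (toℕ-mod (m + n))) (trans (cong toℕ eq) (toℕ-mod (m + o)))
    below : ∀ {n o} → o < k → (m + n) % k ≡ (m + o) % k → o ≤ n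
    below {n} {o} o<k eq = m∸n≡0⇒m≤n (∣∧<⇒≡0 k∣o∸n (≤-<-trans (m∸n≤m o n) o<k))
      where
      k∣o∸n : k ∣ o ∸ n
      k∣o∸n = subst (k ∣_) ([m+n]∸[m+o]≡n∸o m o n) (m%n≡o%n⇒n∣o∸m (m + n) k (m + o) eq)

  mod-suc-cycAdj : ∀ m → CycAdj (m mod k) (suc m mod k)
  mod-suc-cycAdj m with m≤n⇒m<n∨m≡n (m%n<n m k)
  ... | inj₁ 1+r<k = inj₁ $ begin
    suc (toℕ (m mod k)) ≡⟨ cong suc (toℕ-mod m) ⟩
    suc (m % k)         ≡⟨ m<n⇒m%n≡m 1+r<k ⟨
    suc (m % k) % k     ≡⟨ [1+m]%n≡[1+m%n]%n m k ⟨
    suc m % k           ≡⟨ toℕ-mod (suc m) ⟨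
    toℕ (suc m mod k)   ∎
    where open ≡-Reasoning
  ... | inj₂ 1+r≡k = inj₂ (inj₂ (inj₂ (wraps , trans (cong suc (toℕ-mod m)) 1+r≡k)))
    where
    wraps : toℕ (suc m mod k) ≡ 0
    wraps = begin
      toℕ (suc m mod k) ≡⟨ toℕ-mod (suc m) ⟩
      suc m % k         ≡⟨ [1+m]%n≡[1+m%n]%n m k ⟩
      suc (m % k) % k   ≡⟨ cong (_% k) 1+r≡k ⟩
      k % k             ≡⟨ n%n≡0 k ⟩
      0                 ∎
      where open ≡-Reasoning

2*ℓ≤2+e∧e+e<2*ℓ+2⇒ℓ≤2 : ∀ {ℓ e} → 2 * ℓ ≤ 2 + e → e + e < 2 * ℓ + 2 → ℓ ≤ 2
2*ℓ≤2+e∧e+e<2*ℓ+2⇒ℓ≤2 {ℓ} {e} 2ℓ≤2+e 2e<2ℓ+2 = +-cancelˡ-≤ ℓ ℓ 2 $ begin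
  ℓ + ℓ ≡⟨ double ℓ ⟩
  2 * ℓ ≤⟨ 2ℓ≤2+e ⟩
  2 + e ≤⟨ +-monoʳ-≤ 2 e≤ℓ ⟩
  2 + ℓ ≡⟨ +-comm 2 ℓ ⟩
  ℓ + 2 ∎
  where
  open ≤-Reasoning
  double : ∀ ℓ → ℓ + ℓ ≡ 2 * ℓ
  double = solve-∀
  double+2 : ∀ ℓ → suc ℓ + suc ℓ ≡ 2 * ℓ + 2
  double+2 = solve-∀
  e≤ℓ : e ≤ ℓ
  e≤ℓ = ≮⇒≥ λ ℓ<e → <-irrefl (double+2 ℓ) (≤-<-trans (+-mono-≤ ℓ<e ℓ<e) 2e<2ℓ+2)

ascending-injective : ∀ {a b c} → a < b → b < c → Injective _≡_ _≡_ (lookup (a ∷ b ∷ c ∷ []))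
ascending-injective a<b b<c {0F} {0F} _   = refl
ascending-injective a<b b<c {0F} {1F} a≡b = contradiction a≡b (<⇒≢ a<b)
ascending-injective a<b b<c {0F} {2F} a≡c = contradiction a≡c (<⇒≢ (<-trans a<b b<c))
ascending-injective a<b b<c {1F} {0F} b≡a = contradiction b≡a (>⇒≢ a<b)
ascending-injective a<b b<c {1F} {1F} _   = refl
ascending-injective a<b b<c {1F} {2F} b≡c = contradiction b≡c (<⇒≢ b<c)
ascending-injective a<b b<c {2F} {0F} c≡a = contradiction c≡a (>⇒≢ (<-trans a<b b<c))
ascending-injective a<b b<c {2F} {1F} c≡b = contradiction c≡b (>⇒≢ b<c)
ascending-injective a<b b<c {2F} {2F} _   = refl

-- skip i δ z is z for z ≤ i and z + δ for z > i: the surviving indices after cutting the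
-- δ positions following i out of a path.
skip : ℕ → ℕ → ℕ → ℕ
skip _       _ zero    = zero
skip zero    δ (suc z) = suc z + δ
skip (suc i) δ (suc z) = suc (skip i δ z)

skip-self : ∀ i δ → skip i δ i ≡ i
skip-self zero    δ = refl
skip-self (suc i) δ = cong suc (skip-self i δ)

skip-jump : ∀ i δ → skip i δ (suc i) ≡ suc i + δ
skip-jump zero    δ = refl
skip-jump (suc i) δ = cong suc (skip-jump i δ)

skip-above : ∀ {i z} δ → i < z → skip i δ z ≡ z + δ
skip-above {zero}  {suc z} δ _         = refl
skip-above {suc i} {suc z} δ (s≤s i<z) = cong suc (skip-above δ i<z)

skip-suc : ∀ {i z} δ → z ≢ i → skip i δ (suc z) ≡ suc (skip i δ z)
skip-suc {zero}  {zero}  δ z≢i = contradiction refl z≢i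
skip-suc {zero}  {suc z} δ _   = refl
skip-suc {suc i} {zero}  δ _   = refl
skip-suc {suc i} {suc z} δ z≢i = cong suc (skip-suc δ (z≢i ∘ cong suc))

skip≤+ : ∀ i δ z → skip i δ z ≤ z + δ
skip≤+ _       δ zero    = z≤n
skip≤+ zero    δ (suc z) = ≤-refl
skip≤+ (suc i) δ (suc z) = s≤s (skip≤+ i δ z)

skip-injective : ∀ i δ {z z′} → skip i δ z ≡ skip i δ z′ → z ≡ z′
skip-injective _       δ {zero}  {zero}   _  = refl
skip-injective zero    δ {suc z} {suc z′} eq = +-cancelʳ-≡ δ (suc z) (suc z′) eq
skip-injective (suc i) δ {suc z} {suc z′} eq = cong suc (skip-injective i δ (suc-injective eq))
skip-injective zero    δ {zero}  {suc z′} ()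
skip-injective zero    δ {suc z} {zero}   ()
skip-injective (suc i) δ {zero}  {suc z′} ()
skip-injective (suc i) δ {suc z} {zero}   ()

module _ {n : ℕ} (G : Graph n) where

  internal⇒≢ends : ∀ {s t m v} (P : Path G s t m) → InPathInternal G P v → v ≢ s × v ≢ t
  internal⇒≢ends P (i , (i≢0 , i≢m) , refl) =
    (λ eq → i≢0 (Path.inj P (trans eq (sym (start P))))) ,
    (λ eq → i≢m (Path.inj P (trans eq (sym (end P)))))

  ≢ends⇒internal : ∀ {s t m v} (P : Path G s t m) → InPath G P v → v ≢ s → v ≢ t → InPathInternal G P v
  ≢ends⇒internal P (i , refl) v≢s v≢t = i , ((λ { refl → v≢s (start P) }) , (λ { refl → v≢t (end P) })) , refl

  internal-⊆ : ∀ {s t m m′} (P : Path G s t m) (P′ : Path G s t m′) →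
               (∀ v → InPath G P v → InPath G P′ v) → ∀ v → InPathInternal G P v → InPathInternal G P′ v
  internal-⊆ P P′ P⊆P′ v v∈P*@(i , _ , eq) =
    let v≢s , v≢t = internal⇒≢ends P v∈P* in ≢ends⇒internal P′ (P⊆P′ v (i , eq)) v≢s v≢t

  atMostTwoInternalInN-⊆ : ∀ {s t s′ t′ m m′ k} (P : Path G s t m) (P′ : Path G s′ t′ m′) (C : Hole G k) →
                           (∀ v → InPathInternal G P v → InPathInternal G P′ v) →
                           AtMostTwoInternalInN G P′ C → AtMostTwoInternalInN G P C
  atMostTwoInternalInN-⊆ P P′ C P*⊆P′* atMostTwo f f-inj f∈P*∩N =
    atMostTwo f f-inj (λ x → let x∈P* , x∈N = f∈P*∩N x in P*⊆P′* (f x) x∈P* , x∈N)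

  -- Vertices are indexed by ℕ so that cutting a path needs no Fin arithmetic; the values at
  -- indices beyond the length are junk.
  record ℕPath (s t : Fin n) (m : ℕ) : Set where
    field
      vertex    : ℕ → Fin n
      vertex-0  : vertex 0 ≡ s
      vertex-m  : vertex m ≡ t
      injective : ∀ {i j} → i ≤ m → j ≤ m → vertex i ≡ vertex j → i ≡ j
      adjacent  : ∀ {i} → i < m → Adj G (vertex i) (vertex (suc i))
  open ℕPath

  _∈ᵥ_ : ∀ {s t m} → Fin n → ℕPath s t m → Set
  _∈ᵥ_ {m = m} v Q = ∃ λ i → i ≤ m × vertex Q i ≡ v

  _⊆ᵥ_ : ∀ {s t m s′ t′ m′} → ℕPath s t m → ℕPath s′ t′ m′ → Set
  _⊆ᵥ_ {m = m} Q Q′ = ∀ {i} → i ≤ m → vertex Q i ∈ᵥ Q′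

  ⊆ᵥ-refl : ∀ {s t m} {Q : ℕPath s t m} → Q ⊆ᵥ Q
  ⊆ᵥ-refl {i = i} i≤m = i , i≤m , refl

  ∈ᵥ-⊆ᵥ : ∀ {s t m s′ t′ m′ v} {Q : ℕPath s t m} {Q′ : ℕPath s′ t′ m′} → Q ⊆ᵥ Q′ → v ∈ᵥ Q → v ∈ᵥ Q′
  ∈ᵥ-⊆ᵥ Q⊆Q′ (i , i≤m , refl) = Q⊆Q′ i≤m

  ⊆ᵥ-trans : ∀ {s t m s′ t′ m′ s″ t″ m″} {Q : ℕPath s t m} {Q′ : ℕPath s′ t′ m′} {Q″ : ℕPath s″ t″ m″} →
             Q ⊆ᵥ Q′ → Q′ ⊆ᵥ Q″ → Q ⊆ᵥ Q″
  ⊆ᵥ-trans {Q′ = Q′} {Q″} Q⊆Q′ Q′⊆Q″ i≤m = ∈ᵥ-⊆ᵥ {Q = Q′} {Q″} Q′⊆Q″ (Q⊆Q′ i≤m)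

  Induced : ∀ {s t m} → ℕPath s t m → Set
  Induced {m = m} Q = ∀ {i j} → i ≤ m → j ≤ m → Adj G (vertex Q i) (vertex Q j) → suc i ≡ j ⊎ suc j ≡ i

  Chord : ∀ {s t m} → ℕPath s t m → Set
  Chord {m = m} Q = ∃₂ λ i j → suc i < j × j ≤ m × Adj G (vertex Q i) (vertex Q j)

  chord? : ∀ {s t m} (Q : ℕPath s t m) → Dec (Chord Q)
  chord? {m = m} Q = map′
    (λ (j , j<1+m , i , _ , 1+i<j , i~j) → i , j , 1+i<j , s≤s⁻¹ j<1+m , i~j)
    (λ (i , j , 1+i<j , j≤m , i~j) → j , s≤s j≤m , i , <-trans (n<1+n i) 1+i<j , 1+i<j , i~j)
    (anyUpTo? (λ j → anyUpTo? (λ i → suc i <? j ×-dec adj? G (vertex Q i) (vertex Q j)) j) (suc m))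

  ¬Chord⇒consecutive : ∀ {s t m} {Q : ℕPath s t m} → ¬ Chord Q →
                       ∀ {i j} → i < j → j ≤ m → Adj G (vertex Q i) (vertex Q j) → suc i ≡ j
  ¬Chord⇒consecutive ¬chord i<j j≤m i~j with m≤n⇒m<n∨m≡n i<j
  ... | inj₁ 1+i<j = contradiction (_ , _ , 1+i<j , j≤m , i~j) ¬chord
  ... | inj₂ 1+i≡j = 1+i≡j

  ¬Chord⇒Induced : ∀ {s t m} {Q : ℕPath s t m} → ¬ Chord Q → Induced Q
  ¬Chord⇒Induced {Q = Q} ¬chord {i} {j} i≤m j≤m i~j with <-cmp i j
  ... | tri< i<j _ _ = inj₁ (¬Chord⇒consecutive {Q = Q} ¬chord i<j j≤m i~j)
  ... | tri≈ _ refl _ = contradiction i~j (irrefl G)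
  ... | tri> _ _ j<i = inj₂ (¬Chord⇒consecutive {Q = Q} ¬chord j<i i≤m (Adj-sym G i~j))

  cut : ∀ {s t m} (Q : ℕPath s t m) {i δ} → suc i + δ ≤ m →
        Adj G (vertex Q i) (vertex Q (suc i + δ)) → Σ (ℕPath s t (m ∸ δ)) (_⊆ᵥ Q)
  cut {s} {t} {m} Q {i} {δ} 1+i+δ≤m i~j = Q′ , λ {z} z≤m′ → skip i δ z , in-range z≤m′ , refl
    where
    δ≤m : δ ≤ m
    δ≤m = ≤-trans (m≤n+m δ (suc i)) 1+i+δ≤m
    i<m′ : i < m ∸ δ
    i<m′ = m+n≤o⇒m≤o∸n (suc i) 1+i+δ≤m
    in-range : ∀ {z} → z ≤ m ∸ δ → skip i δ z ≤ m
    in-range {z} z≤m′ = ≤-trans (skip≤+ i δ z) (subst (z + δ ≤_) (m∸n+n≡m δ≤m) (+-monoˡ-≤ δ z≤m′))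
    step : ∀ {z} → z < m ∸ δ → Adj G (vertex Q (skip i δ z)) (vertex Q (skip i δ (suc z)))
    step {z} z<m′ with z ≟ i
    ... | yes refl = subst₂ (λ a b → Adj G (vertex Q a) (vertex Q b))
                       (sym (skip-self i δ)) (sym (skip-jump i δ)) i~j
    ... | no z≢i = subst (λ b → Adj G (vertex Q (skip i δ z)) (vertex Q b)) (sym (skip-suc δ z≢i))
                     (adjacent Q (subst (_≤ m) (skip-suc δ z≢i) (in-range z<m′)))
    Q′ : ℕPath s t (m ∸ δ)
    Q′ = record
      { vertex    = λ z → vertex Q (skip i δ z)
      ; vertex-0  = vertex-0 Q
      ; vertex-m  = trans (cong (vertex Q) (trans (skip-above δ i<m′) (m∸n+n≡m δ≤m))) (vertex-m Q)
      ; injective = λ z≤m′ z′≤m′ eq → skip-injective i δ (injective Q (in-range z≤m′) (in-range z′≤m′) eq)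
      ; adjacent  = step
      }

  cutChord : ∀ {s t m} (Q : ℕPath s t m) → Chord Q → ∃ λ m′ → m′ < m × Σ (ℕPath s t m′) (_⊆ᵥ Q)
  cutChord {m = m} Q (i , j , 1+i<j , j≤m , i~j) =
    m ∸ δ , ∸-monoʳ-< (m<n⇒0<n∸m 1+i<j) (≤-trans (m∸n≤m j (suc i)) j≤m) ,
    cut Q (subst (_≤ m) (sym 1+i+δ≡j) j≤m) (subst (Adj G (vertex Q i) ∘ vertex Q) (sym 1+i+δ≡j) i~j)
    where
    δ = j ∸ suc i
    1+i+δ≡j : suc i + δ ≡ j
    1+i+δ≡j = m+[n∸m]≡n (<⇒≤ 1+i<j)

  record InducedSubpath {s t m} (Q : ℕPath s t m) : Set where
    field
      {length}  : ℕ
      path      : ℕPath s t length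
      isInduced : Induced path
      within    : path ⊆ᵥ Q

  inducedSubpath : ∀ {s t m} (Q : ℕPath s t m) → InducedSubpath Q
  inducedSubpath {s} {t} Q = go Q (<-wellFounded _)
    where
    go : ∀ {m} (Q : ℕPath s t m) → Acc _<_ m → InducedSubpath Q
    go Q (acc shorter) with chord? Q
    ... | no ¬chord = record
      { path = Q ; isInduced = ¬Chord⇒Induced {Q = Q} ¬chord ; within = ⊆ᵥ-refl {Q = Q} }
    ... | yes chord with cutChord Q chord
    ...   | _ , m′<m , Q′ , Q′⊆Q = record
      { path = path ; isInduced = isInduced ; within = ⊆ᵥ-trans {Q = path} {Q′} {Q} within Q′⊆Q }
      where open InducedSubpath (go Q′ (shorter m′<m))

  fromPath : ∀ {s t m} → Path G s t m → ℕPath s t m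
  fromPath {m = m} P = record
    { vertex    = λ i → pv P (i mod suc m)
    ; vertex-0  = start P
    ; vertex-m  = trans (cong (pv P) (toℕ≡⇒mod≡ (toℕ-fromℕ m))) (end P)
    ; injective = λ {i} {j} i≤m j≤m eq →
        trans (sym (mod-index (s≤s i≤m))) (trans (cong toℕ (Path.inj P eq)) (mod-index (s≤s j≤m)))
    ; adjacent  = λ {i} i<m → subst₂ (λ a b → Adj G (pv P a) (pv P b))
        (sym (toℕ≡⇒mod≡ (trans (toℕ-inject₁ (fromℕ< i<m)) (toℕ-fromℕ< i<m))))
        (sym (toℕ≡⇒mod≡ (cong suc (toℕ-fromℕ< i<m))))
        (edges P (fromℕ< i<m))
    }
    where
    mod-index : ∀ {i} → i < suc m → toℕ (i mod suc m) ≡ i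
    mod-index {i} i<1+m = trans (toℕ-mod i) (m<n⇒m%n≡m i<1+m)

  fromPath-⊆ : ∀ {s t m v} (P : Path G s t m) → v ∈ᵥ fromPath P → InPath G P v
  fromPath-⊆ {m = m} P (i , _ , eq) = i mod suc m , eq

  toPath : ∀ {s t m} → ℕPath s t m → Path G s t m
  toPath {m = m} Q = record
    { pv    = λ i → vertex Q (toℕ i)
    ; inj   = λ {i} {j} eq → toℕ-injective (injective Q (toℕ≤pred[n] i) (toℕ≤pred[n] j) eq)
    ; start = vertex-0 Q
    ; end   = trans (cong (vertex Q) (toℕ-fromℕ m)) (vertex-m Q)
    ; edges = λ i → subst (λ x → Adj G (vertex Q x) (vertex Q (suc (toℕ i)))) (sym (toℕ-inject₁ i))
                          (adjacent Q (toℕ<n i))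
    }

  toPath-induced : ∀ {s t m} (Q : ℕPath s t m) → Induced Q → InducedPath G (toPath Q)
  toPath-induced Q induced i j = induced (toℕ≤pred[n] i) (toℕ≤pred[n] j)

  toPath-⊆ : ∀ {s t m v} (Q : ℕPath s t m) → InPath G (toPath Q) v → v ∈ᵥ Q
  toPath-⊆ Q (i , eq) = toℕ i , toℕ≤pred[n] i , eq

  toPath-internal : ∀ {s t m v} (Q : ℕPath s t m) → InPathInternal G (toPath Q) v →
                    ∃ λ x → 0 < x × x < m × vertex Q x ≡ v
  toPath-internal {m = m} Q (i , (i≢0 , i≢m) , eq) =
    toℕ i ,
    n≢0⇒n>0 (i≢0 ∘ toℕ-injective) ,
    ≤∧≢⇒< (toℕ≤pred[n] i) (λ i≡m → i≢m (toℕ-injective (trans i≡m (sym (toℕ-fromℕ m))))) ,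
    eq

  toPath-internal⁻¹ : ∀ {s t m x} (Q : ℕPath s t m) → 0 < x → x < m → InPathInternal G (toPath Q) (vertex Q x)
  toPath-internal⁻¹ {m = m} {x} Q 0<x x<m =
    ≢ends⇒internal (toPath Q) (fromℕ< x<1+m , cong (vertex Q) (toℕ-fromℕ< x<1+m))
      (λ eq → <⇒≢ 0<x (sym (injective Q (<⇒≤ x<m) z≤n (trans eq (sym (vertex-0 Q))))))
      (λ eq → <⇒≢ x<m (injective Q (<⇒≤ x<m) ≤-refl (trans eq (sym (vertex-m Q)))))
    where
    x<1+m : x < suc m
    x<1+m = m<n⇒m<1+n x<m

  closeCycle : ∀ {s t e w} (Q : ℕPath s t e) → 1 ≤ e → (∀ {i} → i ≤ e → vertex Q i ≢ w) →
               Adj G w s → Adj G w t → Cycle G (2 + e)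
  closeCycle {s} {t} {e} {w} Q 1≤e avoids w~s w~t = record
    { cv    = λ i → around (toℕ i)
    ; len≥3 = s≤s (s≤s 1≤e)
    ; inj   = λ {i} {j} eq → toℕ-injective (around-injective (toℕ≤pred[n] i) (toℕ≤pred[n] j) eq)
    ; edges = cycle-edges
    }
    where
    around : ℕ → Fin n
    around zero    = w
    around (suc i) = vertex Q i

    around-injective : ∀ {i j} → i ≤ suc e → j ≤ suc e → around i ≡ around j → i ≡ j
    around-injective {zero}  {zero}  _   _   _  = refl
    around-injective {zero}  {suc j} _   j≤e eq = contradiction (sym eq) (avoids (s≤s⁻¹ j≤e))
    around-injective {suc i} {zero}  i≤e _   eq = contradiction eq (avoids (s≤s⁻¹ i≤e))
    around-injective {suc i} {suc j} i≤e j≤e eq = cong suc (injective Q (s≤s⁻¹ i≤e) (s≤s⁻¹ j≤e) eq)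

    step : ∀ {i} → i ≤ e → Adj G (around i) (around (suc i))
    step {zero}  _   = subst (Adj G w) (sym (vertex-0 Q)) w~s
    step {suc i} i<e = adjacent Q i<e

    forward : ∀ {i j : Fin (2 + e)} → suc (toℕ i) ≡ toℕ j → Adj G (around (toℕ i)) (around (toℕ j))
    forward {i} {j} 1+i≡j = subst (Adj G (around (toℕ i)) ∘ around) 1+i≡j
                              (step (s≤s⁻¹ (subst (_≤ suc e) (sym 1+i≡j) (toℕ≤pred[n] j))))

    closing : ∀ {i j : Fin (2 + e)} → toℕ i ≡ 0 → suc (toℕ j) ≡ 2 + e → Adj G (around (toℕ i)) (around (toℕ j))
    closing i≡0 1+j≡2+e rewrite i≡0 | suc-injective 1+j≡2+e = subst (Adj G w) (sym (vertex-m Q)) w~t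

    cycle-edges : ∀ i j → CycAdj i j → Adj G (around (toℕ i)) (around (toℕ j))
    cycle-edges i j (inj₁ 1+i≡j)                          = forward 1+i≡j
    cycle-edges i j (inj₂ (inj₁ 1+j≡i))                   = Adj-sym G (forward 1+j≡i)
    cycle-edges i j (inj₂ (inj₂ (inj₁ (i≡0 , 1+j≡2+e))))  = closing i≡0 1+j≡2+e
    cycle-edges i j (inj₂ (inj₂ (inj₂ (j≡0 , 1+i≡2+e)))) = Adj-sym G (closing j≡0 1+i≡2+e)

  AtMostOneNeighbourOn : ∀ {k} → Hole G k → Set
  AtMostOneNeighbourOn C =
    ∀ {w} → ¬ InHole G C w → ∀ {a b} → Adj G w (hv C a) → Adj G w (hv C b) → a ≡ b

  module _ {k} (C : Hole G k) where
    private instance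
      k≢0 : NonZero k
      k≢0 = >-nonZero (≤-trans (s≤s z≤n) (len≥4 C))

    arc : ∀ a {e} → e < k → ℕPath (hv C (a mod k)) (hv C ((a + e) mod k)) e
    arc a {e} e<k = record
      { vertex    = λ r → hv C ((a + r) mod k)
      ; vertex-0  = cong (λ r → hv C (r mod k)) (+-identityʳ a)
      ; vertex-m  = refl
      ; injective = λ r≤e r′≤e eq →
          +-cancelˡ-mod a (≤-<-trans r≤e e<k) (≤-<-trans r′≤e e<k) (Hole.inj C eq)
      ; adjacent  = λ {r} _ → subst (λ x → Adj G (hv C ((a + r) mod k)) (hv C (x mod k))) (sym (+-suc a r))
                                    (Hole.edges C _ _ (mod-suc-cycAdj (a + r)))
      }

    twoNeighbours⇒shortCycle : ∀ {w} → ¬ InHole G C w → ∀ {a b} → a F.< b →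
                               Adj G w (hv C a) → Adj G w (hv C b) → ∃ λ e → e + e ≤ k × Cycle G (2 + e)
    twoNeighbours⇒shortCycle {w} w∉C {a} {b} a<b w~a w~b = shorterArc (d + d ≤? k)
      where
      A = toℕ a
      B = toℕ b
      d = B ∸ A
      d<k : d < k
      d<k = ≤-<-trans (m∸n≤m B A) (toℕ<n b)
      A+d≡B : A + d ≡ B
      A+d≡B = m+[n∸m]≡n (<⇒≤ a<b)
      B+[k∸d]≡A+k : B + (k ∸ d) ≡ A + k
      B+[k∸d]≡A+k = begin
        B + (k ∸ d)       ≡⟨ cong (_+ (k ∸ d)) A+d≡B ⟨
        A + d + (k ∸ d)   ≡⟨ +-assoc A d (k ∸ d) ⟩
        A + (d + (k ∸ d)) ≡⟨ cong (A +_) (m+[n∸m]≡n (<⇒≤ d<k)) ⟩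
        A + k             ∎
        where open ≡-Reasoning

      attach : ∀ {x} {c : Fin k} → x % k ≡ toℕ c → Adj G w (hv C c) → Adj G w (hv C (x mod k))
      attach x%k≡c = subst (Adj G w ∘ hv C) (sym (%≡toℕ⇒mod≡ x%k≡c))

      closeArc : ∀ x {e} (e<k : e < k) → 1 ≤ e → Adj G w (hv C (x mod k)) → Adj G w (hv C ((x + e) mod k)) →
                 Cycle G (2 + e)
      closeArc x e<k 1≤e = closeCycle (arc x e<k) 1≤e (λ _ eq → w∉C (_ , eq))

      shorterArc : Dec (d + d ≤ k) → ∃ λ e → e + e ≤ k × Cycle G (2 + e)
      shorterArc (yes 2d≤k) =
        d , 2d≤k ,
        closeArc A d<k (m<n⇒0<n∸m a<b)
          (attach (m<n⇒m%n≡m (toℕ<n a)) w~a)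
          (attach (trans (cong (_% k) A+d≡B) (m<n⇒m%n≡m (toℕ<n b))) w~b)
      shorterArc (no 2d≰k) =
        k ∸ d , 2e≤k ,
        closeArc B (∸-monoʳ-< (m<n⇒0<n∸m a<b) (<⇒≤ d<k)) (m<n⇒0<n∸m d<k)
          (attach (m<n⇒m%n≡m (toℕ<n b)) w~b)
          (attach (trans (cong (_% k) B+[k∸d]≡A+k) (trans ([m+n]%n≡m%n A k) (m<n⇒m%n≡m (toℕ<n a)))) w~a)
        where
        2e≤k : (k ∸ d) + (k ∸ d) ≤ k
        2e≤k = subst ((k ∸ d) + (k ∸ d) ≤_) (m∸n+n≡m (<⇒≤ d<k))
                 (+-monoʳ-≤ (k ∸ d) (m≤n+o⇒m∸n≤o k d (<⇒≤ (≰⇒> 2d≰k))))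

  atMostOneNeighbourOnShortHole : ∀ {ℓ} → 3 ≤ ℓ → (∀ k → Cycle G k → 2 * ℓ ≤ k) →
                                  ∀ {k} (C : Hole G k) → k < 2 * ℓ + 2 → AtMostOneNeighbourOn C
  atMostOneNeighbourOnShortHole 3≤ℓ girth C k<2ℓ+2 w∉C {a} {b} w~a w~b = compare (<-cmpᶠ a b)
    where
    noShortCycle : (∃ λ e → e + e ≤ _ × Cycle G (2 + e)) → ⊥
    noShortCycle (e , 2e≤k , cycle) =
      <⇒≱ 3≤ℓ (2*ℓ≤2+e∧e+e<2*ℓ+2⇒ℓ≤2 (girth _ cycle) (≤-<-trans 2e≤k k<2ℓ+2))
    compare : Tri (a F.< b) (a ≡ b) (b F.< a) → a ≡ b
    compare (tri< a<b _ _) = ⊥-elim (noShortCycle (twoNeighbours⇒shortCycle C w∉C a<b w~a w~b))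
    compare (tri≈ _ a≡b _) = a≡b
    compare (tri> _ _ b<a) = ⊥-elim (noShortCycle (twoNeighbours⇒shortCycle C w∉C b<a w~b w~a))

  module _ {k} (C : Hole G k) (oneNeighbour : AtMostOneNeighbourOn C)
           {s t} (s∈C : InHole G C s) (t∈C : InHole G C t) where

    noInteriorAttachment : ∀ {L} (Q : ℕPath s t L) →
      (∀ v → InPathInternal G (toPath Q) v → ¬ InHole G C v) → AtMostTwoInternalInN G (toPath Q) C →
      ∀ {a x} → hv C a ≢ s → hv C a ≢ t → 0 < x → x < L → ¬ Adj G (hv C a) (vertex Q x)
    noInteriorAttachment {suc L′} Q Q*∩C=∅ atMostTwo {a} {x} a≢s a≢t 0<x x<L a~x =
      cases (x ≟ 1) (x ≟ L′)
      where
      x~a = Adj-sym G a~x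
      x≤L′ = s≤s⁻¹ x<L
      0<L′ = ≤-trans 0<x x≤L′

      off-C : ∀ {y} → 0 < y → y < suc L′ → ¬ InHole G C (vertex Q y)
      off-C 0<y y<L = Q*∩C=∅ _ (toPath-internal⁻¹ Q 0<y y<L)

      first~s : Adj G (vertex Q 1) (hv C (proj₁ s∈C))
      first~s = subst (Adj G (vertex Q 1)) (trans (vertex-0 Q) (sym (proj₂ s∈C)))
                  (Adj-sym G (adjacent Q (s≤s z≤n)))

      last~t : Adj G (vertex Q L′) (hv C (proj₁ t∈C))
      last~t = subst (Adj G (vertex Q L′)) (trans (vertex-m Q) (sym (proj₂ t∈C))) (adjacent Q ≤-refl)

      cases : Dec (x ≡ 1) → Dec (x ≡ L′) → ⊥
      cases (yes refl) _      = a≢s (trans (cong (hv C) (oneNeighbour (off-C 0<x x<L) x~a first~s)) (proj₂ s∈C))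
      cases (no _) (yes refl) = a≢t (trans (cong (hv C) (oneNeighbour (off-C 0<x x<L) x~a last~t)) (proj₂ t∈C))
      cases (no x≢1) (no x≢L′) = atMostTwo (vertex Q ∘ lookup ys) ys-injective ys∈Q*∩N
        where
        ys = 1 ∷ x ∷ L′ ∷ []
        attached : ∀ j → 0 < lookup ys j × lookup ys j < suc L′ × ∃ λ c → Adj G (vertex Q (lookup ys j)) (hv C c)
        attached 0F = s≤s z≤n , s≤s 0<L′ , _ , first~s
        attached 1F = 0<x , x<L , a , x~a
        attached 2F = 0<L′ , ≤-refl , _ , last~t
        ys-injective : Injective _≡_ _≡_ (vertex Q ∘ lookup ys)
        ys-injective {i} {j} eq =
          ascending-injective (≤∧≢⇒< 0<x (x≢1 ∘ sym)) (≤∧≢⇒< x≤L′ x≢L′)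
            (injective Q (<⇒≤ (proj₁ (proj₂ (attached i)))) (<⇒≤ (proj₁ (proj₂ (attached j)))) eq)
        ys∈Q*∩N : ∀ j → InPathInternal G (toPath Q) (vertex Q (lookup ys j)) × InN G C (vertex Q (lookup ys j))
        ys∈Q*∩N j = let 0<y , y<L , c , y~c = attached j in
          toPath-internal⁻¹ Q 0<y y<L , off-C 0<y y<L , c , y~c

    shortJump : ∀ {L} (Q : ℕPath s t L) → Induced Q →
                (∀ v → InPathInternal G (toPath Q) v → ¬ InHole G C v) → AtMostTwoInternalInN G (toPath Q) C →
                ShortJump G C s t
    shortJump Q induced Q*∩C=∅ atMostTwo = record
      { path      = toPath Q
      ; isInduced = toPath-induced Q induced
      ; outside   = Q*∩C=∅
      ; short     = short
      }
      where
      short : ∀ a v → hv C a ≢ s → hv C a ≢ t → InPathInternal G (toPath Q) v → ¬ Adj G (hv C a) v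
      short a v a≢s a≢t v∈Q* with toPath-internal Q v∈Q*
      ... | x , 0<x , x<L , refl = noInteriorAttachment Q Q*∩C=∅ atMostTwo a≢s a≢t 0<x x<L

lemma2p4 : (ℓ : ℕ) → 3 ≤ ℓ → {n : ℕ} → (G : Graph n) →
    GirthExactly G (2 * ℓ) → NoEvenHoleAtLeast G (2 * ℓ + 2) →
    {k : ℕ} → (C : Hole G k) → Even G k →
    (s t : Fin n) → InHole G C s → InHole G C t → ¬ Adj G s t →
    {m : ℕ} → (P : Path G s t m) →
    (∀ v → InPathInternal G P v → ¬ InHole G C v) →
    AtMostTwoInternalInN G P C →
    Σ (ShortJump G C s t) λ J →
      ∀ v → InPath G (ShortJump.path J) v → InPath G P v
lemma2p4 ℓ 3≤ℓ G (_ , girth) noLongEvenHole C k-even s t s∈C t∈C _ P P*∩C=∅ atMostTwo =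
  shortJump G C oneNeighbour s∈C t∈C path isInduced (λ v → P*∩C=∅ v ∘ Q*⊆P* v)
    (atMostTwoInternalInN-⊆ G (toPath G path) P C Q*⊆P* atMostTwo) ,
  Q⊆P
  where
  oneNeighbour : AtMostOneNeighbourOn G C
  oneNeighbour = atMostOneNeighbourOnShortHole G 3≤ℓ girth C (≰⇒> (noLongEvenHole _ C k-even))
  open InducedSubpath (inducedSubpath G (fromPath G P))
  Q⊆P : ∀ v → InPath G (toPath G path) v → InPath G P v
  Q⊆P v = fromPath-⊆ G P ∘ ∈ᵥ-⊆ᵥ G {Q = path} {fromPath G P} within ∘ toPath-⊆ G path
  Q*⊆P* : ∀ v → InPathInternal G (toPath G path) v → InPathInternal G P v
  Q*⊆P* = internal-⊆ G (toPath G path) P Q⊆P
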